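{- The number of vertices of a $d$-dimensional face of $ASM_n$ is at most $2^d$.
   Context: An $n\times n$ alternating sign matrix (ASM) is a matrix with entries in $\{0,1,-1\}$ whose rows and columns each sum to $1$ and in which the nonzero entries of each row and of each column alternate in sign. $ASM_n\subset\mathbb{R}^{n\times n}$ is the convex hull of all $n\times n$ ASMs; its vertices are exactly the $n\times n$ ASMs. -}

module Defs where

open import Data.Nat using (ℕ; zero; suc)
open import Data.Fin using (Fin)
open import Data.Integer as ℤ using (ℤ; +_; -[1+_])
open import Data.Rational as ℚ using (ℚ; 0ℚ; _/_)
open import Data.Vec using (Vec; []; _∷_; lookup; foldr; map; zipWith; tabulate)
open import Data.List using (List; []; _∷_; filter)
open import Data.Vec.Relation.Unary.All as VAll using ()
open import Data.Product using (_×_; Σ; _,_)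
open import Data.Sum using (_⊎_)
open import Data.Empty using (⊥)
open import Relation.Nullary using (¬_)
open import Relation.Nullary.Decidable using (¬?)
open import Relation.Binary.PropositionalEquality using (_≡_)

Mat : ℕ → Set
Mat n = Vec (Vec ℤ n) n

entry : ∀ {n} → Mat n → Fin n → Fin n → ℤ
entry A i j = lookup (lookup A i) j

row : ∀ {n} → Mat n → Fin n → Vec ℤ n
row A i = lookup A i

col : ∀ {n} → Mat n → Fin n → Vec ℤ n
col A j = map (λ r → lookup r j) A

sumℤ : ∀ {k} → Vec ℤ k → ℤ
sumℤ = foldr _ ℤ._+_ (+ 0)

nonzeros : ∀ {k} → Vec ℤ k → List ℤ
nonzeros [] = []
nonzeros (x ∷ xs) with x ℤ.≟ + 0
... | Relation.Nullary.yes _ = nonzeros xs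
... | Relation.Nullary.no _ = x ∷ nonzeros xs

AlternatesInSign : List ℤ → Set
AlternatesInSign [] = Data.Unit.⊤ where import Data.Unit
AlternatesInSign (x ∷ []) = Data.Unit.⊤ where import Data.Unit
AlternatesInSign (x ∷ y ∷ rest) = (x ℤ.* y ℤ.< + 0) × AlternatesInSign (y ∷ rest)

IsSignEntry : ℤ → Set
IsSignEntry x = (x ≡ + 0) ⊎ ((x ≡ + 1) ⊎ (x ≡ -[1+ 0 ]))

GoodLine : ∀ {n} → Vec ℤ n → Set
GoodLine v = (sumℤ v ≡ + 1) × AlternatesInSign (nonzeros v)

IsASM : ∀ {n} → Mat n → Set
IsASM {n} A =
  (∀ i j → IsSignEntry (entry A i j)) ×
  (∀ i → GoodLine (row A i)) ×
  (∀ j → GoodLine (col A j))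

toℚ : ℤ → ℚ
toℚ z = z / 1

sumℚ : ∀ {k} → Vec ℚ k → ℚ
sumℚ = foldr _ ℚ._+_ 0ℚ

pairing : ∀ {n} → (Fin n → Fin n → ℚ) → Mat n → ℚ
pairing {n} c A = sumℚ (tabulate λ i → sumℚ (tabulate λ j → c i j ℚ.* toℚ (entry A i j)))

-- The face of ASM_n cut out by the linear functional c (maximising c),
-- described by its vertex set: the ASMs A at which ⟨c,·⟩ is maximal
-- over ASM_n (equivalently, over all ASMs).
InFace : ∀ {n} → (Fin n → Fin n → ℚ) → Mat n → Set
InFace c A = IsASM A × (∀ B → IsASM B → pairing c B ℚ.≤ pairing c A)

AffinelyIndependent : ∀ {n k} → Vec (Mat n) k → Set
AffinelyIndependent {n} {k} ps =
  (λs : Vec ℚ k) →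
  sumℚ λs ≡ 0ℚ →
  (∀ i j → sumℚ (zipWith (λ l p → l ℚ.* toℚ (entry p i j)) λs ps) ≡ 0ℚ) →
  VAll.All (λ l → l ≡ 0ℚ) λs

-- The (affine) dimension of the convex hull of a set S of points is d:
-- S contains d+1 affinely independent points but not d+2.
HasDimension : ∀ {n} → (Mat n → Set) → ℕ → Set
HasDimension {n} S d =
  Σ (Vec (Mat n) (suc d)) (λ ps → VAll.All S ps × AffinelyIndependent ps) ×
  ((ps : Vec (Mat n) (suc (suc d))) → VAll.All S ps → ¬ AffinelyIndependent ps)

-- ASMs sit in the cube {0,1}^{n×n} after the linear, injective change of coordinates
-- A ↦ (Σ_{j' ≤ j} A i j')_{i,j}: in a row whose nonzero entries alternate in sign and sum
-- to 1, the nonzero entries start with +1, so every partial row sum is 0 or 1.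
-- For 0/1 points the bound is a halving argument: a coordinate separating two of the
-- points splits them into two nonempty level sets; if there are more than 2^(k+1) points,
-- one level set has more than 2^k of them and so, inductively, contains k+2 affinely
-- independent points, and any point of the other level set, lying off the hyperplane
-- of the first, extends them to k+3. Nothing about faces is used: any set of ASMs of
-- affine dimension d has at most 2^d elements.
module Submission where

open import Defs
open import Data.Nat using (ℕ; _≤_; _^_)
open import Data.Fin using (Fin)
open import Data.Rational using (ℚ)
open import Data.List using (List; length)
open import Data.List.Relation.Unary.All using (All)
open import Data.List.Relation.Unary.Unique.Propositional using (Unique)

open import Level using (0ℓ)
open import Function using (_∘_)
open import Data.Nat as ℕ using (zero; suc; _<_; s≤s)
import Data.Nat.Properties as ℕP
open import Data.Fin using (zero; suc)
import Data.Fin.Properties as FinP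
open import Data.Integer as ℤ using (ℤ; +_; -[1+_]; +[1+_]; +≤+; +<+; -≤+)
import Data.Integer.Properties as ℤP
open import Data.Integer.GCD using (gcd; gcd-zeroʳ)
open import Data.Rational as ℚ using (0ℚ; 1ℚ; ↥_; 1/_; _+_; _-_; _*_)
import Data.Rational.Properties as ℚP
open import Data.Rational.Solver using (module +-*-Solver)
open import Algebra.Properties.Group ℚP.+-0-group using (∙-cancelˡ; x∙y⁻¹≈ε⇒x≈y)
open import Data.Vec using (Vec; []; _∷_; lookup; zipWith)
import Data.Vec.Relation.Unary.All as VAll
open import Data.Vec.Relation.Binary.Pointwise.Extensional using (ext; Pointwise-≡⇒≡)
open import Data.List as List using ([]; _∷_; filter)
import Data.List.Relation.Unary.All as All
import Data.List.Relation.Unary.All.Properties as AllP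
import Data.List.Relation.Unary.Unique.Propositional.Properties as UniqueP
open import Data.List.Relation.Unary.AllPairs using (_∷_)
open import Data.Maybe.Relation.Unary.All as MAll using (just; nothing)
open import Data.Product using (Σ; ∃; _×_; _,_; proj₁; proj₂; uncurry)
open import Data.Sum as Sum using (_⊎_; inj₁; inj₂)
open import Data.Unit using (tt)
open import Relation.Nullary using (¬_; Dec; yes; no; ¬?; contradiction)
open import Relation.Unary using (Pred; Decidable; _⊆_; _∩_)
open import Relation.Binary.PropositionalEquality

infix 4 _∈[_,_]

_∈[_,_] : {A : Set} → A → A → A → Set
x ∈[ a , b ] = x ≡ a ⊎ x ≡ b

coordinate : ∀ {n} → Fin n → Fin n → Mat n → ℚ
coordinate i j p = toℚ (entry p i j)

weightedSum : ∀ {n k} → Vec ℚ k → Vec (Mat n) k → (Mat n → ℚ) → ℚ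
weightedSum λs ps f = sumℚ (zipWith (λ l p → l * f p) λs ps)

-- A functional is linear iff it kills every linear relation between points; this is
-- the only way linearity is used, so we take it as the definition.
Linear : ∀ {n} → (Mat n → ℚ) → Set
Linear {n} f = ∀ {k} (λs : Vec ℚ k) (ps : Vec (Mat n) k) →
  (∀ i j → weightedSum λs ps (coordinate i j) ≡ 0ℚ) → weightedSum λs ps f ≡ 0ℚ

weightedSum-+ : ∀ {n k} (λs : Vec ℚ k) (ps : Vec (Mat n) k) (f g : Mat n → ℚ) →
  weightedSum λs ps (λ p → f p + g p) ≡ weightedSum λs ps f + weightedSum λs ps g
weightedSum-+ [] [] f g = refl
weightedSum-+ (l ∷ λs) (p ∷ ps) f g = begin
  l * (f p + g p) + weightedSum λs ps (λ p → f p + g p)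
    ≡⟨ cong (λ x → l * (f p + g p) + x) (weightedSum-+ λs ps f g) ⟩
  l * (f p + g p) + (weightedSum λs ps f + weightedSum λs ps g)
    ≡⟨ distribute l (f p) (g p) _ _ ⟩
  (l * f p + weightedSum λs ps f) + (l * g p + weightedSum λs ps g) ∎
  where
  open ≡-Reasoning
  open +-*-Solver
  distribute : ∀ a b c d e → a * (b + c) + (d + e) ≡ (a * b + d) + (a * c + e)
  distribute = solve 5 (λ a b c d e → a :* (b :+ c) :+ (d :+ e) := (a :* b :+ d) :+ (a :* c :+ e)) refl

weightedSum-const : ∀ {n k} (λs : Vec ℚ k) (ps : Vec (Mat n) k) {f : Mat n → ℚ} {a : ℚ} →
  VAll.All (λ p → f p ≡ a) ps → weightedSum λs ps f ≡ sumℚ λs * a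
weightedSum-const [] [] {a = a} VAll.[] = sym (ℚP.*-zeroˡ a)
weightedSum-const (l ∷ λs) (p ∷ ps) {a = a} (refl VAll.∷ fps≡a) =
  trans (cong (λ x → l * a + x) (weightedSum-const λs ps fps≡a)) (sym (ℚP.*-distribʳ-+ a l (sumℚ λs)))

linear-+ : ∀ {n} {f g : Mat n → ℚ} → Linear f → Linear g → Linear (λ p → f p + g p)
linear-+ {f = f} {g} f-linear g-linear λs ps relation =
  trans (weightedSum-+ λs ps f g) (cong₂ _+_ (f-linear λs ps relation) (g-linear λs ps relation))

prefixSum : ∀ {m} → (Fin m → ℚ) → Fin m → ℚ
prefixSum f zero = f zero
prefixSum f (suc j) = f zero + prefixSum (f ∘ suc) j

prefixSum-injective : ∀ {m} (f g : Fin m → ℚ) →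
  (∀ j → prefixSum f j ≡ prefixSum g j) → ∀ j → f j ≡ g j
prefixSum-injective f g eq zero = eq zero
prefixSum-injective f g eq (suc j) = prefixSum-injective (f ∘ suc) (g ∘ suc) tails-equal j
  where
  tails-equal : ∀ k → prefixSum (f ∘ suc) k ≡ prefixSum (g ∘ suc) k
  tails-equal k = ∙-cancelˡ (f zero) _ _
    (trans (eq (suc k)) (cong (_+ prefixSum (g ∘ suc) k) (sym (eq zero))))

linear-prefixSum : ∀ {n m} (φ : Fin m → Mat n → ℚ) → (∀ j → Linear (φ j)) →
  ∀ j → Linear (λ p → prefixSum (λ j′ → φ j′ p) j)
linear-prefixSum φ φ-linear zero = φ-linear zero
linear-prefixSum φ φ-linear (suc j) =
  linear-+ (φ-linear zero) (linear-prefixSum (φ ∘ suc) (φ-linear ∘ suc) j)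

linePrefixSum : ∀ {m} → Vec ℤ m → Fin m → ℚ
linePrefixSum v = prefixSum (toℚ ∘ lookup v)

rowPrefixSum : ∀ {n} → Fin n → Fin n → Mat n → ℚ
rowPrefixSum i j A = linePrefixSum (row A i) j

linear-rowPrefixSum : ∀ {n} (i j : Fin n) → Linear (rowPrefixSum i j)
linear-rowPrefixSum i = linear-prefixSum (coordinate i) (λ j′ λs ps relation → relation i j′)

↥-toℚ : ∀ x → ↥ (toℚ x) ≡ x
↥-toℚ x = begin
  ↥ (toℚ x)                ≡⟨ sym (ℤP.*-identityʳ _) ⟩
  ↥ (toℚ x) ℤ.* + 1         ≡⟨ cong (↥ (toℚ x) ℤ.*_) (sym (gcd-zeroʳ x)) ⟩
  ↥ (toℚ x) ℤ.* gcd x (+ 1) ≡⟨ ℚP.↥-/ x 1 ⟩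
  x ∎
  where open ≡-Reasoning

toℚ-injective : ∀ {x y} → toℚ x ≡ toℚ y → x ≡ y
toℚ-injective {x} {y} eq = trans (sym (↥-toℚ x)) (trans (cong ↥_ eq) (↥-toℚ y))

rowPrefixSums-injective : ∀ {n} (A B : Mat n) →
  (∀ i j → rowPrefixSum i j A ≡ rowPrefixSum i j B) → A ≡ B
rowPrefixSums-injective A B eq = Pointwise-≡⇒≡ (ext λ i → Pointwise-≡⇒≡ (ext λ j →
  toℚ-injective (prefixSum-injective _ _ (eq i) j)))

rowPrefixSums-separate : ∀ {n} (A B : Mat n) → A ≢ B →
  ∃ λ (ij : Fin n × Fin n) → uncurry rowPrefixSum ij A ≢ uncurry rowPrefixSum ij B
rowPrefixSums-separate {n} A B A≢B = separate (FinP.all? (FinP.all? ∘ equal?))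
  where
  equal? : ∀ i j → Dec (rowPrefixSum i j A ≡ rowPrefixSum i j B)
  equal? i j = rowPrefixSum i j A ℚP.≟ rowPrefixSum i j B
  separate : Dec (∀ i j → rowPrefixSum i j A ≡ rowPrefixSum i j B) →
    ∃ λ (ij : Fin n × Fin n) → uncurry rowPrefixSum ij A ≢ uncurry rowPrefixSum ij B
  separate (yes equal) = contradiction (rowPrefixSums-injective A B equal) A≢B
  separate (no ¬equal) =
    let i , ¬equal-i = FinP.¬∀⟶∃¬ n _ (FinP.all? ∘ equal?) ¬equal
        j , differ = FinP.¬∀⟶∃¬ n _ (equal? i) ¬equal-i
    in (i , j) , differ

SignEntries : ∀ {m} → Vec ℤ m → Set
SignEntries v = ∀ j → IsSignEntry (lookup v j)

-- s is the sign of the first nonzero entry, once in ℤ for the total (the one GoodLine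
-- constrains) and once in ℚ for the prefix sums.
LineSumsIn : ℤ → ℚ → ∀ {m} → Vec ℤ m → Set
LineSumsIn s s′ v = sumℤ v ∈[ + 0 , s ] × (∀ j → linePrefixSum v j ∈[ 0ℚ , s′ ])

StartsNonneg StartsNonpos : List ℤ → Set
StartsNonneg l = MAll.All (+ 0 ℤ.≤_) (List.head l)
StartsNonpos l = MAll.All (ℤ._≤ + 0) (List.head l)

starts-nonneg-or-nonpos : ∀ l → StartsNonneg l ⊎ StartsNonpos l
starts-nonneg-or-nonpos [] = inj₁ nothing
starts-nonneg-or-nonpos (y ∷ _) = Sum.map just just (ℤP.≤-total (+ 0) y)

alternates-tail : ∀ {x} l → AlternatesInSign (x ∷ l) → AlternatesInSign l
alternates-tail [] _ = tt
alternates-tail (_ ∷ _) (_ , alternates) = alternates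

alternates-after-+1 : ∀ l → AlternatesInSign (+ 1 ∷ l) → StartsNonpos l
alternates-after-+1 [] _ = nothing
alternates-after-+1 (+ zero ∷ _) _ = just (+≤+ ℕ.z≤n)
alternates-after-+1 (+[1+ _ ] ∷ _) (+<+ () , _)
alternates-after-+1 (-[1+ _ ] ∷ _) _ = just -≤+

alternates-after--1 : ∀ l → AlternatesInSign (-[1+ 0 ] ∷ l) → StartsNonneg l
alternates-after--1 [] _ = nothing
alternates-after--1 (+ _ ∷ _) _ = just (+≤+ ℕ.z≤n)
alternates-after--1 (-[1+ _ ] ∷ _) (+<+ () , _)

lineSums-0∷ : ∀ {s s′ m} {v : Vec ℤ m} → LineSumsIn s s′ v → LineSumsIn s s′ (+ 0 ∷ v)
lineSums-0∷ {s} {s′} (sum , prefix) =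
  subst (λ x → x ∈[ + 0 , s ]) (sym (ℤP.+-identityˡ _)) sum , λ where
    zero → inj₁ refl
    (suc j) → subst (λ x → x ∈[ 0ℚ , s′ ]) (sym (ℚP.+-identityˡ _)) (prefix j)

lineSums-+1∷ : ∀ {m} {v : Vec ℤ m} → LineSumsIn -[1+ 0 ] (ℚ.- 1ℚ) v → LineSumsIn (+ 1) 1ℚ (+ 1 ∷ v)
lineSums-+1∷ (sum , prefix) = shiftℤ sum , λ where
    zero → inj₂ refl
    (suc j) → shiftℚ (prefix j)
  where
  shiftℤ : ∀ {x} → x ∈[ + 0 , -[1+ 0 ] ] → + 1 ℤ.+ x ∈[ + 0 , + 1 ]
  shiftℤ (inj₁ refl) = inj₂ refl
  shiftℤ (inj₂ refl) = inj₁ refl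
  shiftℚ : ∀ {x} → x ∈[ 0ℚ , ℚ.- 1ℚ ] → 1ℚ + x ∈[ 0ℚ , 1ℚ ]
  shiftℚ (inj₁ refl) = inj₂ refl
  shiftℚ (inj₂ refl) = inj₁ refl

lineSums--1∷ : ∀ {m} {v : Vec ℤ m} → LineSumsIn (+ 1) 1ℚ v → LineSumsIn -[1+ 0 ] (ℚ.- 1ℚ) (-[1+ 0 ] ∷ v)
lineSums--1∷ (sum , prefix) = shiftℤ sum , λ where
    zero → inj₂ refl
    (suc j) → shiftℚ (prefix j)
  where
  shiftℤ : ∀ {x} → x ∈[ + 0 , + 1 ] → -[1+ 0 ] ℤ.+ x ∈[ + 0 , -[1+ 0 ] ]
  shiftℤ (inj₁ refl) = inj₂ refl
  shiftℤ (inj₂ refl) = inj₁ refl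
  shiftℚ : ∀ {x} → x ∈[ 0ℚ , 1ℚ ] → ℚ.- 1ℚ + x ∈[ 0ℚ , ℚ.- 1ℚ ]
  shiftℚ (inj₁ refl) = inj₂ refl
  shiftℚ (inj₂ refl) = inj₁ refl

nonneg-lineSums : ∀ {m} (v : Vec ℤ m) → SignEntries v → AlternatesInSign (nonzeros v) →
  StartsNonneg (nonzeros v) → LineSumsIn (+ 1) 1ℚ v
nonpos-lineSums : ∀ {m} (v : Vec ℤ m) → SignEntries v → AlternatesInSign (nonzeros v) →
  StartsNonpos (nonzeros v) → LineSumsIn -[1+ 0 ] (ℚ.- 1ℚ) v

nonneg-lineSums [] _ _ _ = inj₁ refl , λ ()
nonneg-lineSums (x ∷ v) signs alternates start with signs zero
... | inj₁ refl = lineSums-0∷ (nonneg-lineSums v (signs ∘ suc) alternates start)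
... | inj₂ (inj₁ refl) = lineSums-+1∷ (nonpos-lineSums v (signs ∘ suc)
  (alternates-tail _ alternates) (alternates-after-+1 _ alternates))
nonneg-lineSums (.(-[1+ 0 ]) ∷ v) signs alternates (just ()) | inj₂ (inj₂ refl)

nonpos-lineSums [] _ _ _ = inj₁ refl , λ ()
nonpos-lineSums (x ∷ v) signs alternates start with signs zero
... | inj₁ refl = lineSums-0∷ (nonpos-lineSums v (signs ∘ suc) alternates start)
nonpos-lineSums (.(+ 1) ∷ v) signs alternates (just (+≤+ ())) | inj₂ (inj₁ refl)
... | inj₂ (inj₂ refl) = lineSums--1∷ (nonneg-lineSums v (signs ∘ suc)
  (alternates-tail _ alternates) (alternates-after--1 _ alternates))

goodLine-prefixSum-01 : ∀ {m} (v : Vec ℤ m) → SignEntries v → GoodLine v →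
  ∀ j → linePrefixSum v j ∈[ 0ℚ , 1ℚ ]
goodLine-prefixSum-01 v signs (sum≡1 , alternates) with starts-nonneg-or-nonpos (nonzeros v)
... | inj₁ nonneg = proj₂ (nonneg-lineSums v signs alternates nonneg)
... | inj₂ nonpos = contradiction (proj₁ (nonpos-lineSums v signs alternates nonpos)) (+1∉ sum≡1)
  where
  +1∉ : ∀ {x} → x ≡ + 1 → ¬ x ∈[ + 0 , -[1+ 0 ] ]
  +1∉ refl (inj₁ ())
  +1∉ refl (inj₂ ())

asm-rowPrefixSum-01 : ∀ {n} {A : Mat n} → IsASM A → ∀ i j → rowPrefixSum i j A ∈[ 0ℚ , 1ℚ ]
asm-rowPrefixSum-01 {A = A} (signs , rows , _) i = goodLine-prefixSum-01 (row A i) (signs i) (rows i)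

IndependentPointsIn : ∀ {n} → Pred (Mat n) 0ℓ → ℕ → Set
IndependentPointsIn {n} S k = Σ (Vec (Mat n) k) λ ps → VAll.All S ps × AffinelyIndependent ps

p*q≡0⇒p≡0 : ∀ p q → q ≢ 0ℚ → p * q ≡ 0ℚ → p ≡ 0ℚ
p*q≡0⇒p≡0 p q q≢0 pq≡0 = begin
  p                 ≡⟨ sym (ℚP.*-identityʳ p) ⟩
  p * 1ℚ            ≡⟨ cong (p *_) (sym (ℚP.*-inverseʳ q)) ⟩
  p * (q * 1/ q)    ≡⟨ sym (ℚP.*-assoc p q (1/ q)) ⟩
  p * q * 1/ q      ≡⟨ cong (_* 1/ q) pq≡0 ⟩
  0ℚ * 1/ q         ≡⟨ ℚP.*-zeroˡ (1/ q) ⟩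
  0ℚ                ∎
  where
  open ≡-Reasoning
  instance _ = ℚ.≢-nonZero q≢0

singleton-affinelyIndependent : ∀ {n} (p : Mat n) → AffinelyIndependent (p ∷ [])
singleton-affinelyIndependent p (l ∷ []) l+0≡0 _ = trans (sym (ℚP.+-identityʳ l)) l+0≡0 VAll.∷ VAll.[]

-- Applying f to a relation with weight l on q gives l * (f q - a) = 0, so l = 0.
affinelyIndependent-∷ : ∀ {n k} {f : Mat n → ℚ} {a : ℚ} {q : Mat n} {ps : Vec (Mat n) k} →
  Linear f → VAll.All (λ p → f p ≡ a) ps → f q ≢ a →
  AffinelyIndependent ps → AffinelyIndependent (q ∷ ps)
affinelyIndependent-∷ {f = f} {a} {q} {ps} f-linear fps≡a fq≢a independent (l ∷ λs) Σ≡0 relation =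
  l≡0 VAll.∷ independent λs (drop-zero l≡0 Σ≡0) (λ i j → drop-zero (l*x≡0 _) (relation i j))
  where
  open ≡-Reasoning
  open +-*-Solver
  rearrange : ∀ l x s a → l * (x - a) ≡ (l * x + s * a) - (l + s) * a
  rearrange = solve 4 (λ l x s a → l :* (x :- a) := (l :* x :+ s :* a) :- (l :+ s) :* a) refl
  l≡0 : l ≡ 0ℚ
  l≡0 = p*q≡0⇒p≡0 l (f q - a) (fq≢a ∘ x∙y⁻¹≈ε⇒x≈y (f q) a) (begin
    l * (f q - a)                                  ≡⟨ rearrange l (f q) (sumℚ λs) a ⟩
    (l * f q + sumℚ λs * a) - (l + sumℚ λs) * a
      ≡⟨ cong₂ _-_ (trans (cong (λ x → l * f q + x) (sym (weightedSum-const λs ps fps≡a)))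
                          (f-linear (l ∷ λs) (q ∷ ps) relation))
                   (cong (_* a) Σ≡0) ⟩
    0ℚ - 0ℚ * a                                    ≡⟨ cong (0ℚ -_) (ℚP.*-zeroˡ a) ⟩
    0ℚ                                             ∎)
  drop-zero : ∀ {x y} → x ≡ 0ℚ → x + y ≡ 0ℚ → y ≡ 0ℚ
  drop-zero {y = y} refl x+y≡0 = trans (sym (ℚP.+-identityˡ y)) x+y≡0
  l*x≡0 : ∀ x → l * x ≡ 0ℚ
  l*x≡0 x = trans (cong (_* x) l≡0) (ℚP.*-zeroˡ x)

independentPoints-∷ : ∀ {n k} {S : Pred (Mat n) 0ℓ} {f : Mat n → ℚ} {a : ℚ} {q : Mat n} →
  Linear f → S q → f q ≢ a → IndependentPointsIn (S ∩ (λ A → f A ≡ a)) k → IndependentPointsIn S (suc k)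
independentPoints-∷ {q = q} f-linear Sq fq≢a (ps , Sps , independent) =
  q ∷ ps , Sq VAll.∷ VAll.map proj₁ Sps ,
  affinelyIndependent-∷ f-linear (VAll.map proj₂ Sps) fq≢a independent

length-filter-∁ : ∀ {A : Set} {P : Pred A 0ℓ} (P? : Decidable P) xs →
  length xs ≡ length (filter P? xs) ℕ.+ length (filter (¬? ∘ P?) xs)
length-filter-∁ P? [] = refl
length-filter-∁ P? (x ∷ xs) with P? x
... | yes _ = cong suc (length-filter-∁ P? xs)
... | no _ = trans (cong suc (length-filter-∁ P? xs)) (sym (ℕP.+-suc _ _))

2*m<a+b⇒m<a⊎m<b : ∀ m a b → 2 ℕ.* m < a ℕ.+ b → m < a ⊎ m < b
2*m<a+b⇒m<a⊎m<b m a b 2m<a+b with m ℕP.<? a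
... | yes m<a = inj₁ m<a
... | no m≮a = inj₂ (subst (_< b) (ℕP.+-identityʳ m) (ℕP.+-cancelˡ-< m (m ℕ.+ 0) b
  (ℕP.<-≤-trans 2m<a+b (ℕP.+-monoˡ-≤ b (ℕP.≮⇒≥ m≮a)))))

x≢y∧z≢y⇒x≡z : ∀ {A : Set} {a b x y z : A} →
  x ∈[ a , b ] → y ∈[ a , b ] → z ∈[ a , b ] → x ≢ y → z ≢ y → x ≡ z
x≢y∧z≢y⇒x≡z (inj₁ refl) (inj₁ refl) _ x≢y _ = contradiction refl x≢y
x≢y∧z≢y⇒x≡z (inj₂ refl) (inj₂ refl) _ x≢y _ = contradiction refl x≢y
x≢y∧z≢y⇒x≡z (inj₁ refl) (inj₂ refl) (inj₁ refl) _ _ = refl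
x≢y∧z≢y⇒x≡z (inj₁ refl) (inj₂ refl) (inj₂ refl) _ z≢y = contradiction refl z≢y
x≢y∧z≢y⇒x≡z (inj₂ refl) (inj₁ refl) (inj₁ refl) _ z≢y = contradiction refl z≢y
x≢y∧z≢y⇒x≡z (inj₂ refl) (inj₁ refl) (inj₂ refl) _ _ = refl

module LinearCubeEmbedding {n} {I : Set} (B : Pred (Mat n) 0ℓ) (F : I → Mat n → ℚ)
  (F-linear : ∀ t → Linear (F t))
  (F-01 : ∀ t {A} → B A → F t A ∈[ 0ℚ , 1ℚ ])
  (F-separates : ∀ {A A′} → B A → B A′ → A ≢ A′ → ∃ λ t → F t A ≢ F t A′)
  where

  LevelSet : I → ℚ → Pred (Mat n) 0ℓ
  LevelSet t a A = F t A ≡ a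

  independentPoints : ∀ k {S} → S ⊆ B → (V : List (Mat n)) → Unique V → All S V →
    2 ^ k < length V → IndependentPointsIn S (2 ℕ.+ k)
  independentPoints k S⊆B [] _ _ ()
  independentPoints k S⊆B (_ ∷ []) _ _ (s≤s 2^k≤0) = contradiction 2^k≤0 (ℕP.<⇒≱ (ℕP.m^n>0 2 k))
  independentPoints k {S} S⊆B V@(p ∷ q ∷ _) u@((p≢q All.∷ _) ∷ _) SV@(Sp All.∷ Sq All.∷ _) 2^k<∣V∣
    with t , Fp≢Fq ← F-separates (S⊆B Sp) (S⊆B Sq) p≢q = bisect k 2^k<∣V∣
    where
    level? : Decidable (LevelSet t (F t p))
    level? A = F t A ℚP.≟ F t p
    Vp Vq : List (Mat n)
    Vp = filter level? V
    Vq = filter (¬? ∘ level?) V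
    on-p-level : All (S ∩ LevelSet t (F t p)) Vp
    on-p-level = All.zip (AllP.filter⁺ level? SV , AllP.all-filter level? V)
    on-q-level : All (S ∩ LevelSet t (F t q)) Vq
    on-q-level = All.map
      (λ (SA , FA≢Fp) → SA , x≢y∧z≢y⇒x≡z (F-01 t (S⊆B SA)) (F-01 t (S⊆B Sp)) (F-01 t (S⊆B Sq))
                                          FA≢Fp (Fp≢Fq ∘ sym))
      (All.zip (AllP.filter⁺ (¬? ∘ level?) SV , AllP.all-filter (¬? ∘ level?) V))
    bisect : ∀ k → 2 ^ k < length V → IndependentPointsIn S (2 ℕ.+ k)
    bisect zero _ = independentPoints-∷ (F-linear t) Sq (Fp≢Fq ∘ sym)
      (p ∷ [] , (Sp , refl) VAll.∷ VAll.[] , singleton-affinelyIndependent p)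
    bisect (suc k) 2^[1+k]<∣V∣ with 2*m<a+b⇒m<a⊎m<b (2 ^ k) (length Vp) (length Vq)
                                      (subst (2 ^ suc k <_) (length-filter-∁ level? V) 2^[1+k]<∣V∣)
    ... | inj₁ 2^k<∣Vp∣ = independentPoints-∷ (F-linear t) Sq (Fp≢Fq ∘ sym)
      (independentPoints k (S⊆B ∘ proj₁) Vp (UniqueP.filter⁺ level? u) on-p-level 2^k<∣Vp∣)
    ... | inj₂ 2^k<∣Vq∣ = independentPoints-∷ (F-linear t) Sp Fp≢Fq
      (independentPoints k (S⊆B ∘ proj₁) Vq (UniqueP.filter⁺ (¬? ∘ level?) u) on-q-level 2^k<∣Vq∣)

  length≤2^dim : ∀ d {S} → S ⊆ B → ¬ IndependentPointsIn S (2 ℕ.+ d) →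
    (V : List (Mat n)) → Unique V → All S V → length V ≤ 2 ^ d
  length≤2^dim d S⊆B no-more V u SV = ℕP.≮⇒≥ (no-more ∘ independentPoints d S⊆B V u SV)

mainTheorem3 : (n d : ℕ) (c : Fin n → Fin n → ℚ) →
    HasDimension (InFace c) d →
    (vs : List (Mat n)) → Unique vs → All (InFace c) vs →
    length vs ≤ 2 ^ d
mainTheorem3 n d c (_ , no-more) =
  ASMs.length≤2^dim d proj₁ (λ (ps , in-face , independent) → no-more ps in-face independent)
  where
  module ASMs = LinearCubeEmbedding {n} IsASM (uncurry rowPrefixSum) (uncurry linear-rowPrefixSum)
    (λ (i , j) {A} asm → asm-rowPrefixSum-01 {A = A} asm i j) (λ {A} {B} _ _ → rowPrefixSums-separate A B)
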